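{- Let $U_1=a_1+d_1\mathbb Z_{\ge0}$ and $U_2=a_2+d_2\mathbb Z_{\ge0}$ (with $a_1,a_2,d_1,d_2$ natural numbers) be infinite arithmetic progressions in $\mathbb N$ with $U_1\cap U_2\neq\emptyset$. Let $f\colon U_1\cup U_2\to\mathbb Z$ be a function whose restrictions to $U_1$ and to $U_2$ are LIP. Then $f$ is LIP on $U_1\cup U_2$.
   Context: For $S\subseteq\mathbb Z$, a function $f\colon S\to\mathbb Z$ is LIP on $S$ if for every finite $X\subseteq S$ there is $p\in\mathbb Z[x]$ with $p(x)=f(x)$ for all $x\in X$. -}

module Defs where

open import Data.Nat as ℕ using (ℕ)
open import Data.Integer using (ℤ; +_; _+_; _*_)
open import Data.List using (List; []; _∷_)
open import Data.List.Relation.Unary.All using (All)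
open import Data.Product using (Σ; ∃; _×_)
open import Data.Sum using (_⊎_)
open import Relation.Binary.PropositionalEquality using (_≡_)

-- Polynomials in ℤ[x], as coefficient lists (constant term first).
Poly : Set
Poly = List ℤ

eval : Poly → ℤ → ℤ
eval []       x = + 0
eval (c ∷ cs) x = c + x * eval cs x

-- f is LIP on S (S a subset of ℤ given as a predicate; f only matters on S):
-- for every finite X ⊆ S there is p ∈ ℤ[x] with p(x) = f(x) for all x ∈ X.
LIP : (ℤ → Set) → (ℤ → ℤ) → Set
LIP S f = (X : List ℤ) → All S X →
          Σ Poly λ p → All (λ x → eval p x ≡ f x) X

AP : ℕ → ℕ → ℤ → Set
AP a d x = ∃ λ (k : ℕ) → x ≡ + (a ℕ.+ d ℕ.* k)

_∪_ : (ℤ → Set) → (ℤ → Set) → ℤ → Set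
(S ∪ T) x = S x ⊎ T x

-- For a finite X ⊆ ℤ there is N ≠ 0 (a product of differences of points of X) such
-- that every function on X that is divisible by N is interpolated by an integer
-- polynomial.  So it suffices to interpolate f modulo every n ≠ 0.  Write
-- dᵢ = g eᵢ with g = gcd d₁ d₂, and split n = n₁ n₂ with n₁ coprime to e₁ and n₂
-- dividing a power of e₁, hence coprime to e₂.  Since U₁ ∩ U₂ is an arithmetic
-- progression of step d₂ e₁, modulo n₁ every point of U₂ is congruent to a point of
-- U₁ ∩ U₂, and f, being interpolable on U₂, takes congruent values there; so an
-- interpolant of f on U₁ interpolates f on U₁ ∪ U₂ modulo n₁.  Symmetrically modulo
-- n₂, and the Chinese remainder theorem combines the two.

module Submission where

open import Defs
open import Data.Nat as ℕ using (ℕ; NonZero; zero; suc; _<_; _^_)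
import Data.Nat.Properties as ℕ
import Data.Nat.Divisibility as ℕ
import Data.Nat.Tactic.RingSolver as ℕ
open import Data.Nat.DivMod using (_/_; m/n*n≡m; m*[n/m]≡n)
open import Data.Nat.GCD using (gcd; gcd[m,n]∣m; gcd[m,n]∣n; gcd[m,n]≢0; module Bézout)
open import Data.Nat.Coprimality as Coprime
  using (Coprime; coprime?; coprime-divisor; coprime-Bézout; coprime-/gcd; gcd≡1⇒coprime; 1-coprimeTo)
open import Data.Nat.Induction using (<-rec)
open import Data.Integer as ℤ using (ℤ; +_; _+_; _*_; _-_; -_; 0ℤ; 1ℤ; ∣_∣; _%ℕ_; _/ℕ_)
import Data.Integer.Properties as ℤ
open import Data.Integer.DivMod using (a≡a%ℕn+[a/ℕn]*n)
open import Data.Integer.Divisibility.Signed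
  using (_∣_; divides; ∣-trans; ∣m∣n⇒∣m+n; ∣m⇒∣-m; ∣n⇒∣m*n; ∣m⇒∣m*n; m∣∣m∣)
open import Data.Integer.Tactic.RingSolver using (solve-∀)
open import Data.List using (List; []; _∷_)
open import Data.List.Relation.Unary.All as All using (All; []; _∷_)
open import Data.List.Relation.Unary.Any using (here; there)
open import Data.List.Membership.Propositional using (_∈_; _∉_)
open import Data.List.Membership.DecPropositional ℤ._≟_ using (_∈?_)
open import Data.Product using (∃; ∃₂; _×_; _,_; proj₁; proj₂; swap; map₂)
open import Data.Sum as Sum using (inj₁; inj₂)
open import Data.Empty using (⊥-elim)
open import Function using (_∘_)
open import Relation.Nullary using (yes; no)
open import Relation.Binary.PropositionalEquality
open ≡-Reasoning

-- A record rather than an abbreviation of + n ∣ x - y, so that x, y and n are inferable.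
infix 4 _≡_mod_
record _≡_mod_ (x y : ℤ) (n : ℕ) : Set where
  constructor ≡-mod
  field
    ∣-difference : + n ∣ x - y
open _≡_mod_ public

≡-mod-refl : ∀ {n} x → x ≡ x mod n
≡-mod-refl {n} x = ≡-mod (divides 0ℤ (trans (ℤ.+-inverseʳ x) (sym (ℤ.*-zeroˡ (+ n)))))

≡-mod-sym : ∀ {n x y} → x ≡ y mod n → y ≡ x mod n
≡-mod-sym {n} {x} {y} (≡-mod n∣x-y) = ≡-mod (subst (+ n ∣_) (lemma x y) (∣m⇒∣-m n∣x-y))
  where
  lemma : ∀ x y → - (x - y) ≡ y - x
  lemma = solve-∀

≡-mod-trans : ∀ {n x y z} → x ≡ y mod n → y ≡ z mod n → x ≡ z mod n
≡-mod-trans {n} {x} {y} {z} (≡-mod n∣x-y) (≡-mod n∣y-z) =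
  ≡-mod (subst (+ n ∣_) (lemma x y z) (∣m∣n⇒∣m+n n∣x-y n∣y-z))
  where
  lemma : ∀ x y z → (x - y) + (y - z) ≡ x - z
  lemma = solve-∀

infixl 6 _+ₚ_
infixr 7 _·ₚ_

_+ₚ_ : Poly → Poly → Poly
[]      +ₚ q       = q
(c ∷ p) +ₚ []      = c ∷ p
(c ∷ p) +ₚ (d ∷ q) = c + d ∷ p +ₚ q

_·ₚ_ : ℤ → Poly → Poly
a ·ₚ []      = []
a ·ₚ (c ∷ p) = a * c ∷ a ·ₚ p

eval-+ₚ : ∀ p q x → eval (p +ₚ q) x ≡ eval p x + eval q x
eval-+ₚ []      q       x = sym (ℤ.+-identityˡ _)
eval-+ₚ (c ∷ p) []      x = sym (ℤ.+-identityʳ _)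
eval-+ₚ (c ∷ p) (d ∷ q) x = begin
  c + d + x * eval (p +ₚ q) x     ≡⟨ cong (λ e → c + d + x * e) (eval-+ₚ p q x) ⟩
  c + d + x * (eval p x + eval q x) ≡⟨ lemma c d x (eval p x) (eval q x) ⟩
  c + x * eval p x + (d + x * eval q x) ∎
  where
  lemma : ∀ c d x u v → c + d + x * (u + v) ≡ c + x * u + (d + x * v)
  lemma = solve-∀

eval-·ₚ : ∀ a p x → eval (a ·ₚ p) x ≡ a * eval p x
eval-·ₚ a []      x = sym (ℤ.*-zeroʳ a)
eval-·ₚ a (c ∷ p) x = begin
  a * c + x * eval (a ·ₚ p) x ≡⟨ cong (λ e → a * c + x * e) (eval-·ₚ a p x) ⟩
  a * c + x * (a * eval p x) ≡⟨ lemma a c x (eval p x) ⟩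
  a * (c + x * eval p x)     ∎
  where
  lemma : ∀ a c x u → a * c + x * (a * u) ≡ a * (c + x * u)
  lemma = solve-∀

eval-cong-mod : ∀ {n x y} p → x ≡ y mod n → eval p x ≡ eval p y mod n
eval-cong-mod []      _   = ≡-mod-refl 0ℤ
eval-cong-mod {n} {x} {y} (c ∷ p) x≡y@(≡-mod n∣x-y) =
  ≡-mod (subst (+ n ∣_) (lemma c x y (eval p x) (eval p y))
    (∣m∣n⇒∣m+n (∣n⇒∣m*n x (∣-difference (eval-cong-mod p x≡y))) (∣m⇒∣m*n (eval p y) n∣x-y)))
  where
  lemma : ∀ c x y u v → x * (u - v) + (x - y) * v ≡ c + x * u - (c + y * v)
  lemma = solve-∀

vanishing : List ℤ → Poly
vanishing []      = 1ℤ ∷ []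
vanishing (z ∷ Z) = (0ℤ ∷ vanishing Z) +ₚ (- z) ·ₚ vanishing Z

eval-vanishing-∷ : ∀ z Z x → eval (vanishing (z ∷ Z)) x ≡ (x - z) * eval (vanishing Z) x
eval-vanishing-∷ z Z x = begin
  eval ((0ℤ ∷ V) +ₚ (- z) ·ₚ V) x       ≡⟨ eval-+ₚ (0ℤ ∷ V) ((- z) ·ₚ V) x ⟩
  0ℤ + x * eval V x + eval ((- z) ·ₚ V) x ≡⟨ cong (_+_ (0ℤ + x * eval V x)) (eval-·ₚ (- z) V x) ⟩
  0ℤ + x * eval V x + - z * eval V x    ≡⟨ lemma x z (eval V x) ⟩
  (x - z) * eval V x                    ∎
  where
  V : Poly
  V = vanishing Z
  lemma : ∀ x z v → 0ℤ + x * v + - z * v ≡ (x - z) * v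
  lemma = solve-∀

eval-vanishing-∈ : ∀ {z Z} → z ∈ Z → eval (vanishing Z) z ≡ 0ℤ
eval-vanishing-∈ {z} {w ∷ Z} (here refl) = begin
  eval (vanishing (z ∷ Z)) z      ≡⟨ eval-vanishing-∷ z Z z ⟩
  (z - z) * eval (vanishing Z) z  ≡⟨ cong (_* eval (vanishing Z) z) (ℤ.+-inverseʳ z) ⟩
  0ℤ * eval (vanishing Z) z       ≡⟨ ℤ.*-zeroˡ (eval (vanishing Z) z) ⟩
  0ℤ                              ∎
eval-vanishing-∈ {z} {w ∷ Z} (there z∈Z) = begin
  eval (vanishing (w ∷ Z)) z      ≡⟨ eval-vanishing-∷ w Z z ⟩
  (z - w) * eval (vanishing Z) z  ≡⟨ cong ((z - w) *_) (eval-vanishing-∈ z∈Z) ⟩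
  (z - w) * 0ℤ                    ≡⟨ ℤ.*-zeroʳ (z - w) ⟩
  0ℤ                              ∎

eval-vanishing-∉ : ∀ {x} Z → x ∉ Z → eval (vanishing Z) x ≢ 0ℤ
eval-vanishing-∉ {x} []      x∉Z eq with trans (cong (_+_ 1ℤ) (sym (ℤ.*-zeroʳ x))) eq
... | ()
eval-vanishing-∉ {x} (z ∷ Z) x∉Z eq
  with ℤ.i*j≡0⇒i≡0∨j≡0 (x - z) (trans (sym (eval-vanishing-∷ z Z x)) eq)
... | inj₁ x-z≡0 = x∉Z (here (ℤ.i-j≡0⇒i≡j x z x-z≡0))
... | inj₂ V[x]≡0 = eval-vanishing-∉ Z (λ x∈Z → x∉Z (there x∈Z)) V[x]≡0

-- The extra factor M makes the statement strong enough for induction on X.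
InterpolatesMultiplesOf : ℤ → List ℤ → Set
InterpolatesMultiplesOf N X = ∀ M (g : ℤ → ℤ) → All (λ x → N * M ∣ g x) X →
                              ∃ λ q → All (λ x → M * eval q x ≡ g x) X

interpolates-∷-∈ : ∀ {N x X} → x ∈ X → InterpolatesMultiplesOf N X →
                   InterpolatesMultiplesOf N (x ∷ X)
interpolates-∷-∈ x∈X interp M g (_ ∷ N*M∣g) with interp M g N*M∣g
... | q , Mq≡g = q , All.lookup Mq≡g x∈X ∷ Mq≡g

-- Correct an interpolant on X by a multiple of the polynomial vanishing on X; its value
-- D at x is the factor by which the modulus grows.
interpolates-∷-∉ : ∀ {N x X} → x ∉ X → InterpolatesMultiplesOf N X →
                   InterpolatesMultiplesOf (eval (vanishing X) x * N) (x ∷ X)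
interpolates-∷-∉ {N} {x} {X} x∉X interp M g (divides k g[x]≡ ∷ DNM∣g) =
  q , at-x ∷ All.tabulate at-X
  where
  D : ℤ
  D = eval (vanishing X) x
  reassoc : ∀ {z} → D * N * M ∣ g z → N * (D * M) ∣ g z
  reassoc = ∣-trans (divides 1ℤ (lemma D N M))
    where
    lemma : ∀ D N M → D * N * M ≡ 1ℤ * (N * (D * M))
    lemma = solve-∀
  IH : ∃ λ q′ → All (λ z → D * M * eval q′ z ≡ g z) X
  IH = interp (D * M) g (All.map reassoc DNM∣g)
  q′ : Poly
  q′ = proj₁ IH
  h : ℤ
  h = k * N - eval q′ x
  q : Poly
  q = D ·ₚ q′ +ₚ h ·ₚ vanishing X
  eval-q : ∀ z → eval q z ≡ D * eval q′ z + h * eval (vanishing X) z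
  eval-q z = trans (eval-+ₚ (D ·ₚ q′) (h ·ₚ vanishing X) z)
                   (cong₂ _+_ (eval-·ₚ D q′ z) (eval-·ₚ h (vanishing X) z))
  at-x : M * eval q x ≡ g x
  at-x = begin
    M * eval q x                      ≡⟨ cong (M *_) (eval-q x) ⟩
    M * (D * eval q′ x + h * D)       ≡⟨ lemma M D (eval q′ x) k N ⟩
    k * (D * N * M)                   ≡⟨ sym g[x]≡ ⟩
    g x                               ∎
    where
    lemma : ∀ M D u k N → M * (D * u + (k * N - u) * D) ≡ k * (D * N * M)
    lemma = solve-∀
  at-X : ∀ {z} → z ∈ X → M * eval q z ≡ g z
  at-X {z} z∈X = begin
    M * eval q z                                  ≡⟨ cong (M *_) (eval-q z) ⟩
    M * (D * eval q′ z + h * eval (vanishing X) z)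
      ≡⟨ cong (λ v → M * (D * eval q′ z + h * v)) (eval-vanishing-∈ z∈X) ⟩
    M * (D * eval q′ z + h * 0ℤ)                   ≡⟨ lemma M D (eval q′ z) h ⟩
    D * M * eval q′ z                             ≡⟨ All.lookup (proj₂ IH) z∈X ⟩
    g z                                           ∎
    where
    lemma : ∀ M D u h → M * (D * u + h * 0ℤ) ≡ D * M * u
    lemma = solve-∀

interpolates-multiples : ∀ X → ∃ λ N → N ≢ 0ℤ × InterpolatesMultiplesOf N X
interpolates-multiples [] = 1ℤ , (λ ()) , λ _ _ _ → [] , []
interpolates-multiples (x ∷ X) with interpolates-multiples X | x ∈? X
... | N , N≢0 , interp | yes x∈X = N , N≢0 , interpolates-∷-∈ {N} x∈X interp
... | N , N≢0 , interp | no x∉X  = eval (vanishing X) x * N , DN≢0 , interpolates-∷-∉ x∉X interp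
  where
  DN≢0 : eval (vanishing X) x * N ≢ 0ℤ
  DN≢0 DN≡0 with ℤ.i*j≡0⇒i≡0∨j≡0 (eval (vanishing X) x) DN≡0
  ... | inj₁ D≡0 = eval-vanishing-∉ X x∉X D≡0
  ... | inj₂ N≡0 = N≢0 N≡0

interpolation-modulus : ∀ X → ∃ λ N → NonZero N ×
  (∀ g → All (λ x → + N ∣ g x) X → ∃ λ q → All (λ x → eval q x ≡ g x) X)
interpolation-modulus X with interpolates-multiples X
... | N , N≢0 , interp = ∣ N ∣ , ℕ.≢-nonZero (N≢0 ∘ ℤ.∣i∣≡0⇒i≡0) , interpolate
  where
  N*1∣ : ∀ {i} → + ∣ N ∣ ∣ i → N * 1ℤ ∣ i
  N*1∣ = subst (_∣ _) (sym (ℤ.*-identityʳ N)) ∘ ∣-trans m∣∣m∣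
  interpolate : ∀ g → All (λ x → + ∣ N ∣ ∣ g x) X → ∃ λ q → All (λ x → eval q x ≡ g x) X
  interpolate g ∣N∣∣g with interp 1ℤ g (All.map N*1∣ ∣N∣∣g)
  ... | q , q≡g = q , All.map (trans (sym (ℤ.*-identityˡ _))) q≡g

≡⇒≡-mod : ∀ {n x y} → x ≡ y → x ≡ y mod n
≡⇒≡-mod {x = x} refl = ≡-mod-refl x

ApproximableMod : ℕ → (ℤ → Set) → (ℤ → ℤ) → Set
ApproximableMod n S f = ∀ X → All S X → ∃ λ P → All (λ x → f x ≡ eval P x mod n) X

approximable⇒LIP : ∀ {S f} → (∀ n → .{{NonZero n}} → ApproximableMod n S f) → LIP S f
approximable⇒LIP {f = f} approximable X X⊆S with interpolation-modulus X
... | N , N≢0 , interpolate with approximable N {{N≢0}} X X⊆S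
... | P , f≡P with interpolate (λ x → f x - eval P x) (All.map ∣-difference f≡P)
... | q , q≡f-P = P +ₚ q , All.map (λ {x} → eval-P+q≡f x) q≡f-P
  where
  eval-P+q≡f : ∀ x → eval q x ≡ f x - eval P x → eval (P +ₚ q) x ≡ f x
  eval-P+q≡f x q≡ = begin
    eval (P +ₚ q) x               ≡⟨ eval-+ₚ P q x ⟩
    eval P x + eval q x           ≡⟨ cong (_+_ (eval P x)) q≡ ⟩
    eval P x + (f x - eval P x)   ≡⟨ lemma (eval P x) (f x) ⟩
    f x                           ∎
    where
    lemma : ∀ p y → p + (y - p) ≡ y
    lemma = solve-∀

pos-1+*≡* : ∀ a b c d → 1 ℕ.+ a ℕ.* b ≡ c ℕ.* d → 1ℤ + + a * + b ≡ + c * + d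
pos-1+*≡* a b c d eq = begin
  1ℤ + + a * + b    ≡⟨ cong (_+_ 1ℤ) (sym (ℤ.pos-* a b)) ⟩
  + (1 ℕ.+ a ℕ.* b) ≡⟨ cong +_ eq ⟩
  + (c ℕ.* d)       ≡⟨ ℤ.pos-* c d ⟩
  + c * + d         ∎

coprime⇒bézout : ∀ {m n} → Coprime m n → ∃₂ λ α β → α * + m + β * + n ≡ 1ℤ
coprime⇒bézout {m} {n} m⊥n with coprime-Bézout m⊥n
... | Bézout.+- x y 1+yn≡xm = + x , - + y , (begin
  + x * + m + - + y * + n       ≡⟨ cong (λ t → t + - + y * + n) (sym (pos-1+*≡* y n x m 1+yn≡xm)) ⟩
  1ℤ + + y * + n + - + y * + n  ≡⟨ lemma (+ y) (+ n) ⟩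
  1ℤ                            ∎)
  where
  lemma : ∀ y n → 1ℤ + y * n + - y * n ≡ 1ℤ
  lemma = solve-∀
... | Bézout.-+ x y 1+xm≡yn = - + x , + y , (begin
  - + x * + m + + y * + n       ≡⟨ cong (_+_ (- + x * + m)) (sym (pos-1+*≡* x m y n 1+xm≡yn)) ⟩
  - + x * + m + (1ℤ + + x * + m) ≡⟨ lemma (+ x) (+ m) ⟩
  1ℤ                            ∎)
  where
  lemma : ∀ x m → - x * m + (1ℤ + x * m) ≡ 1ℤ
  lemma = solve-∀

-- With α m + β n = 1, the combination β n P₁ + α m P₂ is P₁ modulo m and P₂ modulo n.
approximable-* : ∀ {m n S f} → Coprime m n → ApproximableMod m S f → ApproximableMod n S f →
                 ApproximableMod (m ℕ.* n) S f
approximable-* {m} {n} {f = f} m⊥n approx₁ approx₂ X X⊆S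
  with approx₁ X X⊆S | approx₂ X X⊆S | coprime⇒bézout m⊥n
... | P₁ , f≡P₁ | P₂ , f≡P₂ | α , β , bézout =
  P , All.zipWith (λ (≡P₁ , ≡P₂) → f≡P ≡P₁ ≡P₂) (f≡P₁ , f≡P₂)
  where
  P : Poly
  P = (β * + n) ·ₚ P₁ +ₚ (α * + m) ·ₚ P₂
  f≡P : ∀ {x} → f x ≡ eval P₁ x mod m → f x ≡ eval P₂ x mod n → f x ≡ eval P x mod (m ℕ.* n)
  f≡P {x} (≡-mod (divides u f-P₁≡)) (≡-mod (divides v f-P₂≡)) = ≡-mod (divides (β * u + α * v) (begin
    f x - eval P x
      ≡⟨ cong (_-_ (f x)) (trans (eval-+ₚ ((β * + n) ·ₚ P₁) ((α * + m) ·ₚ P₂) x)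
                              (cong₂ _+_ (eval-·ₚ (β * + n) P₁ x) (eval-·ₚ (α * + m) P₂ x))) ⟩
    f x - (β * + n * eval P₁ x + α * + m * eval P₂ x)
      ≡⟨ split α β (+ m) (+ n) (f x) (eval P₁ x) (eval P₂ x) ⟩
    β * + n * (f x - eval P₁ x) + α * + m * (f x - eval P₂ x) + (1ℤ - (α * + m + β * + n)) * f x
      ≡⟨ cong₂ (λ a b → β * + n * a + α * + m * b + (1ℤ - (α * + m + β * + n)) * f x) f-P₁≡ f-P₂≡ ⟩
    β * + n * (u * + m) + α * + m * (v * + n) + (1ℤ - (α * + m + β * + n)) * f x
      ≡⟨ cong (λ t → β * + n * (u * + m) + α * + m * (v * + n) + (1ℤ - t) * f x) bézout ⟩
    β * + n * (u * + m) + α * + m * (v * + n) + (1ℤ - 1ℤ) * f x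
      ≡⟨ collect α β u v (+ m) (+ n) (f x) ⟩
    (β * u + α * v) * (+ m * + n)
      ≡⟨ cong ((β * u + α * v) *_) (sym (ℤ.pos-* m n)) ⟩
    (β * u + α * v) * + (m ℕ.* n) ∎))
    where
    split : ∀ α β m n y p₁ p₂ → y - (β * n * p₁ + α * m * p₂) ≡
            β * n * (y - p₁) + α * m * (y - p₂) + (1ℤ - (α * m + β * n)) * y
    split = solve-∀
    collect : ∀ α β u v m n y → β * n * (u * m) + α * m * (v * n) + (1ℤ - 1ℤ) * y ≡ (β * u + α * v) * (m * n)
    collect = solve-∀

LIP⇒≡-mod-cong : ∀ {S f n x y} → LIP S f → S x → S y → x ≡ y mod n → f x ≡ f y mod n
LIP⇒≡-mod-cong {f = f} {n} {x} {y} lip x∈S y∈S x≡y with lip (x ∷ y ∷ []) (x∈S ∷ y∈S ∷ [])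
... | P , Px≡fx ∷ Py≡fy ∷ [] = subst₂ (λ a b → a ≡ b mod n) Px≡fx Py≡fy (eval-cong-mod P x≡y)

approximable-via-shadows : ∀ {n S T f} → LIP T f →
  (∀ x → S x → ∃ λ w → T w × x ≡ w mod n × f x ≡ f w mod n) → ApproximableMod n S f
approximable-via-shadows {n} {S} {T} {f} lip shadow X X⊆S =
  let (W , W⊆T , transfer) = shadows X⊆S
      (P , PW≡fW)          = lip W W⊆T
  in  P , transfer P PW≡fW
  where
  shadows : ∀ {X} → All S X → ∃ λ W → All T W ×
            (∀ P → All (λ w → eval P w ≡ f w) W → All (λ x → f x ≡ eval P x mod n) X)
  shadows [] = [] , [] , λ _ _ → []
  shadows {x ∷ X} (x∈S ∷ X⊆S) with shadow x x∈S | shadows X⊆S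
  ... | w , w∈T , x≡w , fx≡fw | W , W⊆T , transfer =
    w ∷ W , w∈T ∷ W⊆T , λ { P (Pw≡fw ∷ PW≡fW) → fx≡Px P Pw≡fw ∷ transfer P PW≡fW }
    where
    fx≡Px : ∀ P → eval P w ≡ f w → f x ≡ eval P x mod n
    fx≡Px P Pw≡fw = ≡-mod-trans fx≡fw (≡-mod-trans (≡⇒≡-mod (sym Pw≡fw))
                                                  (≡-mod-sym (eval-cong-mod P x≡w)))

shadows-in-union : ∀ {A B f n} → LIP B f → (∀ y → B y → ∃ λ w → A w × B w × y ≡ w mod n) →
                   ∀ x → (A ∪ B) x → ∃ λ w → A w × x ≡ w mod n × f x ≡ f w mod n
shadows-in-union {f = f} lip shadow x (inj₁ x∈A) = x , x∈A , ≡-mod-refl x , ≡-mod-refl (f x)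
shadows-in-union {f = f} lip shadow x (inj₂ x∈B) with shadow x x∈B
... | w , w∈A , w∈B , x≡w = w , w∈A , x≡w , LIP⇒≡-mod-cong lip x∈B w∈B x≡w

≢0∧≢1⇒>1 : ∀ {n} → n ≢ 0 → n ≢ 1 → 1 < n
≢0∧≢1⇒>1 {zero}        n≢0 _   = ⊥-elim (n≢0 refl)
≢0∧≢1⇒>1 {suc zero}    _   n≢1 = ⊥-elim (n≢1 refl)
≢0∧≢1⇒>1 {suc (suc n)} _   _   = ℕ.s<s ℕ.z<s

coprime-*ˡ : ∀ {a b c} → Coprime a c → Coprime b c → Coprime (a ℕ.* b) c
coprime-*ˡ {a} a⊥c b⊥c {d} (d∣ab , d∣c) = b⊥c (coprime-divisor d⊥a d∣ab , d∣c)
  where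
  d⊥a : Coprime d a
  d⊥a (k∣d , k∣a) = a⊥c (k∣a , ℕ.∣-trans k∣d d∣c)

coprime-^ˡ : ∀ {a c} → Coprime a c → ∀ K → Coprime (a ^ K) c
coprime-^ˡ {c = c} a⊥c zero    = 1-coprimeTo c
coprime-^ˡ         a⊥c (suc K) = coprime-*ˡ a⊥c (coprime-^ˡ a⊥c K)

coprime-∣ˡ : ∀ {a b c} → b ℕ.∣ a → Coprime a c → Coprime b c
coprime-∣ˡ b∣a a⊥c (d∣b , d∣c) = a⊥c (ℕ.∣-trans d∣b b∣a , d∣c)

CoprimeSplit : ℕ → ℕ → Set
CoprimeSplit e N = ∃₂ λ N₁ N₂ → N ≡ N₁ ℕ.* N₂ × (∃ λ K → N₂ ℕ.∣ e ^ K) × Coprime e N₁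

-- Divide out gcd e N until what is left is coprime to e.
coprime-split : ∀ e N → .{{NonZero N}} → CoprimeSplit e N
coprime-split e = <-rec (λ N → .{{NonZero N}} → CoprimeSplit e N) split
  where
  split : ∀ N → (∀ {M} → M < N → .{{NonZero M}} → CoprimeSplit e M) → .{{NonZero N}} → CoprimeSplit e N
  split N rec with coprime? e N
  ... | yes e⊥N = N , 1 , sym (ℕ.*-identityʳ N) , (0 , ℕ.∣-refl) , e⊥N
  ... | no ¬e⊥N with gcd[m,n]∣n e N
  ... | ℕ.divides N₀ N≡N₀g = extend (rec (subst (N₀ <_) (sym N≡N₀g) (ℕ.m<m*n N₀ g 1<g)))
    where
    g : ℕ
    g = gcd e N
    1<g : 1 < g
    1<g = ≢0∧≢1⇒>1 (gcd[m,n]≢0 e N (inj₂ (ℕ.≢-nonZero⁻¹ N))) (¬e⊥N ∘ gcd≡1⇒coprime)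
    instance
      N₀≢0 : NonZero N₀
      N₀≢0 = ℕ.≢-nonZero λ { refl → ℕ.≢-nonZero⁻¹ N N≡N₀g }
    extend : CoprimeSplit e N₀ → CoprimeSplit e N
    extend (N₁ , N₂ , N₀≡N₁N₂ , (K , N₂∣eᴷ) , e⊥N₁) =
      N₁ , g ℕ.* N₂ , N≡N₁[gN₂] , (suc K , ℕ.*-pres-∣ (gcd[m,n]∣m e N) N₂∣eᴷ) , e⊥N₁
      where
      N≡N₁[gN₂] : N ≡ N₁ ℕ.* (g ℕ.* N₂)
      N≡N₁[gN₂] = begin
        N                 ≡⟨ N≡N₀g ⟩
        N₀ ℕ.* g          ≡⟨ cong (ℕ._* g) N₀≡N₁N₂ ⟩
        N₁ ℕ.* N₂ ℕ.* g   ≡⟨ lemma N₁ N₂ g ⟩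
        N₁ ℕ.* (g ℕ.* N₂) ∎
        where
        lemma : ∀ a b c → a ℕ.* b ℕ.* c ≡ a ℕ.* (c ℕ.* b)
        lemma = ℕ.solve-∀

coprime-cofactors : ∀ d₁ d₂ → .{{NonZero d₁}} → ∃₂ λ e₁ e₂ → Coprime e₁ e₂ × d₁ ℕ.* e₂ ≡ d₂ ℕ.* e₁
coprime-cofactors d₁ d₂ = d₁ / g , d₂ / g , coprime-/gcd d₁ d₂ , (begin
  d₁ ℕ.* (d₂ / g)             ≡⟨ cong (ℕ._* (d₂ / g)) (sym (m/n*n≡m (gcd[m,n]∣m d₁ d₂))) ⟩
  d₁ / g ℕ.* g ℕ.* (d₂ / g)   ≡⟨ ℕ.*-assoc (d₁ / g) g (d₂ / g) ⟩
  d₁ / g ℕ.* (g ℕ.* (d₂ / g)) ≡⟨ cong (d₁ / g ℕ.*_) (m*[n/m]≡n (gcd[m,n]∣n d₁ d₂)) ⟩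
  d₁ / g ℕ.* d₂               ≡⟨ ℕ.*-comm (d₁ / g) d₂ ⟩
  d₂ ℕ.* (d₁ / g)             ∎)
  where
  g : ℕ
  g = gcd d₁ d₂
  instance
    g≢0 : NonZero g
    g≢0 = ℕ.≢-nonZero (gcd[m,n]≢0 d₁ d₂ (inj₁ (ℕ.≢-nonZero⁻¹ d₁)))

natural-representative : ∀ r n → .{{NonZero n}} → ∃ λ m → + m ≡ r mod n
natural-representative r n = r %ℕ n , ≡-mod (divides (- (r /ℕ n)) (begin
  + (r %ℕ n) - r                              ≡⟨ cong (_-_ (+ (r %ℕ n))) (a≡a%ℕn+[a/ℕn]*n r n) ⟩
  + (r %ℕ n) - (+ (r %ℕ n) + r /ℕ n * + n)    ≡⟨ lemma (+ (r %ℕ n)) (r /ℕ n) (+ n) ⟩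
  - (r /ℕ n) * + n                            ∎))
  where
  lemma : ∀ m q n → m - (m + q * n) ≡ - q * n
  lemma = solve-∀

-- A Bézout coefficient of e inverts e modulo n; reducing mod n makes the solution natural.
coprime⇒solvable : ∀ {e n} .{{_ : NonZero n}} → Coprime e n → ∀ r → ∃ λ m → + e * + m ≡ r mod n
coprime⇒solvable {e} {n} e⊥n r with coprime⇒bézout e⊥n
... | α , β , bézout with natural-representative (α * r) n
... | m , ≡-mod (divides u m-αr≡) = m , ≡-mod (divides (+ e * u - β * r) (begin
  + e * + m - r
    ≡⟨ expand (+ e) (+ m) r α β (+ n) ⟩
  + e * (+ m - α * r) + (α * + e + β * + n) * r - r - β * + n * r
    ≡⟨ cong₂ (λ a b → + e * a + b * r - r - β * + n * r) m-αr≡ bézout ⟩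
  + e * (u * + n) + 1ℤ * r - r - β * + n * r
    ≡⟨ collect (+ e) u r β (+ n) ⟩
  (+ e * u - β * r) * + n ∎))
  where
  expand : ∀ e m r α β n → e * m - r ≡ e * (m - α * r) + (α * e + β * n) * r - r - β * n * r
  expand = solve-∀
  collect : ∀ e u r β n → e * (u * n) + 1ℤ * r - r - β * n * r ≡ (e * u - β * r) * n
  collect = solve-∀

pos-affine : ∀ a d k → + (a ℕ.+ d ℕ.* k) ≡ + a + + d * + k
pos-affine a d k = trans (ℤ.pos-+ a (d ℕ.* k)) (cong (_+_ (+ a)) (ℤ.pos-* d k))

AP-index-cong : ∀ {n} a d k k₂ e m → + e * + m ≡ + k - + k₂ mod n →
  + (a ℕ.+ d ℕ.* k) ≡ + (a ℕ.+ d ℕ.* (k₂ ℕ.+ e ℕ.* m)) mod n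
AP-index-cong {n} a d k k₂ e m (≡-mod (divides u em≡)) = ≡-mod (divides (- + d * u) (begin
  + (a ℕ.+ d ℕ.* k) - + (a ℕ.+ d ℕ.* (k₂ ℕ.+ e ℕ.* m))
    ≡⟨ cong₂ _-_ (pos-affine a d k)
         (trans (pos-affine a d _) (cong (λ t → + a + + d * t) (pos-affine k₂ e m))) ⟩
  + a + + d * + k - (+ a + + d * (+ k₂ + + e * + m))
    ≡⟨ factor (+ a) (+ d) (+ k) (+ k₂) (+ e * + m) ⟩
  - + d * (+ e * + m - (+ k - + k₂))
    ≡⟨ cong (λ t → - + d * t) em≡ ⟩
  - + d * (u * + n)
    ≡⟨ reassoc (+ d) u (+ n) ⟩
  (- + d * u) * + n ∎))
  where
  factor : ∀ a d k k₂ t → a + d * k - (a + d * (k₂ + t)) ≡ - d * (t - (k - k₂))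
  factor = solve-∀
  reassoc : ∀ d u n → - d * (u * n) ≡ (- d * u) * n
  reassoc = solve-∀

-- The witnesses are c + d₂ e₁ m (= c + d₁ e₂ m) for a common point c.
AP-shadow : ∀ a₁ d₁ a₂ d₂ e₁ e₂ {n} .{{_ : NonZero n}} →
  d₁ ℕ.* e₂ ≡ d₂ ℕ.* e₁ → Coprime e₁ n → (∃ λ c → AP a₁ d₁ c × AP a₂ d₂ c) →
  ∀ y → AP a₂ d₂ y → ∃ λ w → AP a₁ d₁ w × AP a₂ d₂ w × y ≡ w mod n
AP-shadow a₁ d₁ a₂ d₂ e₁ e₂ {n} d₁e₂≡d₂e₁ e₁⊥n (c , (k₁ , c≡₁) , (k₂ , c≡₂)) y (k , refl) =
  shadow (coprime⇒solvable e₁⊥n (+ k - + k₂))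
  where
  c₂≡c₁ : a₂ ℕ.+ d₂ ℕ.* k₂ ≡ a₁ ℕ.+ d₁ ℕ.* k₁
  c₂≡c₁ = ℤ.+-injective (trans (sym c≡₂) c≡₁)
  common-step : ∀ m → a₂ ℕ.+ d₂ ℕ.* (k₂ ℕ.+ e₁ ℕ.* m) ≡ a₁ ℕ.+ d₁ ℕ.* (k₁ ℕ.+ e₂ ℕ.* m)
  common-step m = begin
    a₂ ℕ.+ d₂ ℕ.* (k₂ ℕ.+ e₁ ℕ.* m)      ≡⟨ shift a₂ d₂ k₂ e₁ m ⟩
    a₂ ℕ.+ d₂ ℕ.* k₂ ℕ.+ d₂ ℕ.* e₁ ℕ.* m ≡⟨ cong₂ (λ s t → s ℕ.+ t ℕ.* m) c₂≡c₁ (sym d₁e₂≡d₂e₁) ⟩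
    a₁ ℕ.+ d₁ ℕ.* k₁ ℕ.+ d₁ ℕ.* e₂ ℕ.* m ≡⟨ sym (shift a₁ d₁ k₁ e₂ m) ⟩
    a₁ ℕ.+ d₁ ℕ.* (k₁ ℕ.+ e₂ ℕ.* m)      ∎
    where
    shift : ∀ a d k e m → a ℕ.+ d ℕ.* (k ℕ.+ e ℕ.* m) ≡ a ℕ.+ d ℕ.* k ℕ.+ d ℕ.* e ℕ.* m
    shift = ℕ.solve-∀
  shadow : (∃ λ m → + e₁ * + m ≡ + k - + k₂ mod n) →
           ∃ λ w → AP a₁ d₁ w × AP a₂ d₂ w × + (a₂ ℕ.+ d₂ ℕ.* k) ≡ w mod n
  shadow (m , e₁m≡k-k₂) = + (a₂ ℕ.+ d₂ ℕ.* (k₂ ℕ.+ e₁ ℕ.* m))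
                        , (k₁ ℕ.+ e₂ ℕ.* m , cong +_ (common-step m))
                        , (k₂ ℕ.+ e₁ ℕ.* m , refl)
                        , AP-index-cong a₂ d₂ k k₂ e₁ m e₁m≡k-k₂

corollary6 : (a₁ a₂ d₁ d₂ : ℕ) → NonZero d₁ → NonZero d₂ →
    (∃ λ (x : ℤ) → AP a₁ d₁ x × AP a₂ d₂ x) →
    (f : ℤ → ℤ) → LIP (AP a₁ d₁) f → LIP (AP a₂ d₂) f →
    LIP (AP a₁ d₁ ∪ AP a₂ d₂) f
corollary6 a₁ a₂ d₁ d₂ d₁≢0 _ common f lip₁ lip₂ with coprime-cofactors d₁ d₂ {{d₁≢0}}
... | e₁ , e₂ , e₁⊥e₂ , d₁e₂≡d₂e₁ = approximable⇒LIP approximable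
  where
  approximable : ∀ n → .{{NonZero n}} → ApproximableMod n (AP a₁ d₁ ∪ AP a₂ d₂) f
  approximable n with coprime-split e₁ n
  ... | n₁ , n₂ , refl , (K , n₂∣e₁ᴷ) , e₁⊥n₁ = approximable-* n₁⊥n₂ mod-n₁ mod-n₂
    where
    instance
      n₁≢0 : NonZero n₁
      n₁≢0 = ℕ.m*n≢0⇒m≢0 n₁
      n₂≢0 : NonZero n₂
      n₂≢0 = ℕ.m*n≢0⇒n≢0 n₁
    n₁⊥n₂ : Coprime n₁ n₂
    n₁⊥n₂ = Coprime.sym (coprime-∣ˡ n₂∣e₁ᴷ (coprime-^ˡ e₁⊥n₁ K))
    e₂⊥n₂ : Coprime e₂ n₂
    e₂⊥n₂ = Coprime.sym (coprime-∣ˡ n₂∣e₁ᴷ (coprime-^ˡ e₁⊥e₂ K))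
    mod-n₁ : ApproximableMod n₁ (AP a₁ d₁ ∪ AP a₂ d₂) f
    mod-n₁ = approximable-via-shadows lip₁
      (shadows-in-union lip₂ (AP-shadow a₁ d₁ a₂ d₂ e₁ e₂ d₁e₂≡d₂e₁ e₁⊥n₁ common))
    mod-n₂ : ApproximableMod n₂ (AP a₁ d₁ ∪ AP a₂ d₂) f
    mod-n₂ = approximable-via-shadows lip₂
      (λ x → shadows-in-union lip₁ shadow₂ x ∘ Sum.swap)
      where
      shadow₂ : ∀ y → AP a₁ d₁ y → ∃ λ w → AP a₂ d₂ w × AP a₁ d₁ w × y ≡ w mod n₂
      shadow₂ = AP-shadow a₂ d₂ a₁ d₁ e₂ e₁ (sym d₁e₂≡d₂e₁) e₂⊥n₂ (map₂ swap common)
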